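{- $\beta$ is invariant under cyclic shifts: if $w\in\Sigma_k$ and $w'$ is a cyclic shift of $w$ (as a sequence of letters), then $\beta(w')=\beta(w)$.
   Context: $\Sigma_k$: finite not necessarily reduced words $w=g_{i_1}^{\alpha_1}\cdots g_{i_m}^{\alpha_m}$ ($\alpha_b=\pm1$), $|w|=m$. Associate symbols $s_0,\dots,s_m$ and the trail $s_0\to\cdots\to s_m$ with $b$-th step labeled $g_{i_b}^{\alpha_b}$. A partition of $\{s_0,\dots,s_m\}$ is realizable if for all $h,l$ with $i_h=i_l$: if $\alpha_h=\alpha_l$ then $s_{h-1}\equiv s_{l-1}\iff s_h\equiv s_l$; if $\alpha_h=-\alpha_l$ then $s_{h-1}\equiv s_l\iff s_h\equiv s_{l-1}$. Its quotient graph has the blocks as vertices and, for each $b$, an edge of color $i_b$ from the block of $s_{b-1}$ to that of $s_b$ (reversed if $\alpha_b=-1$), coinciding edges identified. $\mathcal{Q}_w$ is the set of quotient graphs of realizable partitions with $s_0\equiv s_m$; $\chi(\Gamma)=e_\Gamma-v_\Gamma+1$. A set $S$ of pairs of symbols generates $\Gamma$ if the partition of $\Gamma$ is the finest realizable partition in which each pair in $S$ lies in one block. $\Gamma\in\mathcal{Q}_w$ has type A if some generating set of $\Gamma$ of minimum cardinality contains $\{s_0,s_m\}$, and type B otherwise. $\beta(w)=\min\{\chi(\Gamma):\Gamma\in\mathcal{Q}_w\text{ of type B}\}$, or $\infty$ if there is none. -}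

module Defs where

open import Data.Nat using (ℕ; zero; suc) renaming (_≤_ to _≤ℕ_)
open import Data.Fin using (Fin; inject₁; fromℕ) renaming (zero to fzero; suc to fsuc)
open import Data.Fin.Properties using () renaming (_≟_ to _≟F_)
open import Data.List using (List; []; _∷_; length; lookup; map; deduplicate; _++_; allFin)
open import Data.List.Membership.Propositional using (_∈_)
open import Data.Product using (Σ; ∃; ∃-syntax; _×_; _,_; proj₁; proj₂)
open import Data.Product.Properties using (≡-dec)
open import Data.Sum using (_⊎_)
open import Data.Sign using (Sign) renaming (+ to plus; - to minus)
open import Data.Integer using (ℤ; +_; _-_; _+_) renaming (_≤_ to _≤ℤ_)
open import Data.Maybe using (Maybe; just; nothing)
open import Relation.Binary.PropositionalEquality using (_≡_; _≢_)
open import Relation.Nullary using (¬_)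
open import Function.Bundles using (_⇔_)

-- A letter g_i^α : colour i ∈ Fin k, exponent α ∈ {+1,-1} (a Sign).
Letter : ℕ → Set
Letter k = Fin k × Sign

-- Elements of Σ_k: finite, not necessarily reduced words.
Word : ℕ → Set
Word k = List (Letter k)

-- Symbols s_0,…,s_m of a word of length m.
Sym : ∀ {k} → Word k → Set
Sym w = Fin (suc (length w))

-- Steps b = 1..m are indexed 0-based by Fin m.
Step : ∀ {k} → Word k → Set
Step w = Fin (length w)

colour : ∀ {k} (w : Word k) → Step w → Fin k
colour w b = proj₁ (lookup w b)

sign : ∀ {k} (w : Word k) → Step w → Sign
sign w b = proj₂ (lookup w b)

src : ∀ {k} (w : Word k) → Step w → Sym w
src w b = inject₁ b

tgt : ∀ {k} (w : Word k) → Step w → Sym w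
tgt w b = fsuc b

first : ∀ {k} (w : Word k) → Sym w
first w = fzero

last : ∀ {k} (w : Word k) → Sym w
last w = fromℕ (length w)

-- A partition of the symbols, given by a block-labelling: s ≡ t iff p s ≡ p t.
Partition : ∀ {k} → Word k → Set
Partition w = Sym w → Sym w

Same : ∀ {k} (w : Word k) → Partition w → Sym w → Sym w → Set
Same w p s t = p s ≡ p t

Realizable : ∀ {k} (w : Word k) → Partition w → Set
Realizable w p = ∀ (h l : Step w) → colour w h ≡ colour w l →
  ((sign w h ≡ sign w l →
     (Same w p (src w h) (src w l)) ⇔ (Same w p (tgt w h) (tgt w l)))
  × (sign w h ≢ sign w l →
     (Same w p (src w h) (tgt w l)) ⇔ (Same w p (tgt w h) (src w l))))

-- Edges of the quotient graph: (colour, tail block, head block), reversed for α = -1;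
-- coinciding edges are identified (deduplication).
edgeOf : ∀ {k} (w : Word k) → Partition w → Step w → Fin k × Sym w × Sym w
edgeOf w p b with sign w b
... | plus  = colour w b , p (src w b) , p (tgt w b)
... | minus = colour w b , p (tgt w b) , p (src w b)

numEdges : ∀ {k} (w : Word k) → Partition w → ℕ
numEdges {k} w p =
  length (deduplicate (≡-dec _≟F_ (≡-dec _≟F_ _≟F_)) (map (edgeOf w p) (allFin (length w))))

-- Vertices = blocks = distinct labels actually used.
numVertices : ∀ {k} (w : Word k) → Partition w → ℕ
numVertices w p = length (deduplicate _≟F_ (map p (allFin (suc (length w)))))

χ : ∀ {k} (w : Word k) → Partition w → ℤ
χ w p = + numEdges w p - + numVertices w p + + 1

-- Γ ∈ Q_w (Γ represented by its partition)
InQ : ∀ {k} (w : Word k) → Partition w → Set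
InQ w p = Realizable w p × (Same w p (first w) (last w))

PairSet : ∀ {k} → Word k → Set
PairSet w = List (Sym w × Sym w)

Respects : ∀ {k} (w : Word k) → Partition w → PairSet w → Set
Respects w p S = ∀ {s t} → (s , t) ∈ S → Same w p s t

Refines : ∀ {k} (w : Word k) → Partition w → Partition w → Set
Refines w p q = ∀ s t → Same w p s t → Same w q s t

Generates : ∀ {k} (w : Word k) → PairSet w → Partition w → Set
Generates w S p = Realizable w p × Respects w p S
  × (∀ q → Realizable w q → Respects w q S → Refines w p q)

MinGenerates : ∀ {k} (w : Word k) → PairSet w → Partition w → Set
MinGenerates w S p = Generates w S p × (∀ S' → Generates w S' p → length S ≤ℕ length S')

ContainsEnds : ∀ {k} (w : Word k) → PairSet w → Set
ContainsEnds w S = ((first w , last w) ∈ S) ⊎ ((last w , first w) ∈ S)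

TypeA : ∀ {k} (w : Word k) → Partition w → Set
TypeA w p = ∃[ S ] (MinGenerates w S p × ContainsEnds w S)

TypeB : ∀ {k} (w : Word k) → Partition w → Set
TypeB w p = ¬ TypeA w p

-- β(w) ∈ ℤ ∪ {∞}, with nothing = ∞.  IsBeta w b  ⇔  b = β(w).
IsBeta : ∀ {k} → Word k → Maybe ℤ → Set
IsBeta w nothing = ∀ p → InQ w p → ¬ TypeB w p
IsBeta w (just x) = (∃[ p ] (InQ w p × TypeB w p × χ w p ≡ x))
  × (∀ p → InQ w p → TypeB w p → x ≤ℤ χ w p)

CyclicShift : ∀ {k} → Word k → Word k → Set
CyclicShift w w' = ∃[ u ] ∃[ v ] (w ≡ u ++ v × w' ≡ v ++ u)

module Submission where

-- For a closed realizable partition p of the trail of a word, call a step closing if it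
-- traverses an edge not traversed before and reaches an already visited vertex, and let
-- rank p be the number of closing steps.  Two facts about the rank drive the proof:
--   (1) χ p = rank p, counting vertices and edges by the step that discovers them;
--   (2) rank p is the minimum size of a generating set of p: the closing pairs generate
--       p, and fewer pairs cannot, by a dimension count over GF(2) (a nonzero solution of
--       a homogeneous system would yield a strictly finer realizable partition).
-- Moving the last letter of w = x a to the front gives w' = a x.  Relabelling symbols
-- along this rotation matches the closed realizable partitions of w and of w'; it keeps
-- the sets of edges and vertices, hence χ and by (1) the rank, and it moves generating
-- sets containing the end pair.  By (2), type A means that some generating set of size at
-- most the rank contains the end pair, so type A, type B and χ all transfer, and so does
-- β.  A cyclic shift is a sequence of such rotations.

open import Data.Nat using (ℕ; zero; suc; pred; _≤_; _<_; _≤?_; z≤n; s≤s; s≤s⁻¹; _+_) renaming (_≟_ to _≟ℕ_)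
open import Data.Nat.Properties
  using (≤-trans; ≤-refl; ≤-<-trans; <-≤-trans; ≤-reflexive; <⇒≢; <⇒≤; ≤-antisym; ≤∧≢⇒<; +-suc; +-comm; +-monoʳ-<; ≰⇒>; n≤1+n; module ≤-Reasoning)
open import Data.Bool using (Bool; true; false; _xor_)
open import Data.Bool.Properties
  using (xor-same; xor-identityʳ; xor-assoc; xor-∧-commutativeRing) renaming (_≟_ to _≟B_)
open import Algebra.Bundles using (CommutativeRing)
import Algebra.Properties.CommutativeSemigroup
open import Data.Fin using (Fin; toℕ; inject₁; fromℕ; lower₁; cast) renaming (zero to fzero; suc to fsuc; _<_ to _<F_)
open import Data.Fin.Properties
  using (toℕ-injective; toℕ-inject₁; toℕ-fromℕ; inject₁-lower₁; inject₁-injective; fromℕ≢inject₁; subst-is-cast) renaming (_≟_ to _≟F_)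
open import Data.Fin.Induction using (<-wellFounded)
open import Induction.WellFounded using (Acc; acc)
open import Data.Sign using (Sign) renaming (+ to plus; - to minus)
import Data.Sign
open import Data.Vec using (Vec; []; _∷_; lookup; zipWith; replicate)
open import Data.Vec.Properties using (lookup-zipWith)
open import Data.List using (List; []; _∷_; length; filter; map; allFin; deduplicate; tabulate; _++_)
import Data.List as List
open import Data.List.Properties
  using (filter-notAll; filter-≐; length-map; length-++; length-tabulate; length-removeAt′; map-tabulate;
         map-cong; ++-assoc; ++-identityʳ)
open import Data.List.Membership.Propositional using (_∈_)
open import Data.List.Membership.Propositional.Properties
  using (∈-filter⁺; ∈-map⁺; ∈-map⁻; ∈-allFin; ∈-deduplicate⁺; ∈-deduplicate⁻)
open import Data.List.Relation.Binary.Subset.Propositional using (_⊆_)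
open import Data.List.Relation.Unary.Any using (Any; here; there; any?; _─_)
import Data.List.Relation.Unary.Any as Any
open import Data.List.Relation.Unary.Any.Properties using (lookup-result)
open import Data.List.Relation.Unary.All using (All; []; _∷_)
import Data.List.Relation.Unary.All as All
open import Data.List.Relation.Unary.All.Properties using (─⁺; ─⁻; ¬Any⇒All¬; map⁺; map⁻; ++⁺; ++⁻; all-filter)
open import Data.List.Relation.Unary.AllPairs using (AllPairs; []; _∷_)
import Data.List.Relation.Unary.AllPairs.Properties as AllPairs
open import Data.List.Relation.Unary.Unique.Propositional using (Unique)
open import Data.List.Relation.Unary.Unique.Propositional.Properties using (filter⁺; allFin⁺)
open import Data.List.Relation.Unary.Unique.DecPropositional.Properties using (deduplicate-!)
open import Data.Product using (∃; ∃-syntax; _×_; _,_; proj₁; proj₂)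
open import Data.Product.Properties using (≡-dec; ,-injective)
open import Data.Sum using (_⊎_; inj₁; inj₂; [_,_]′)
open import Data.Integer using (ℤ; +_) renaming (_+_ to _+ℤ_; _-_ to _-ℤ_; _≤_ to _≤ℤ_)
open import Data.Integer.Properties using (pos-+; +-injective)
open import Data.Integer.Tactic.RingSolver using (solve-∀)
open import Function.Bundles using (_⇔_; Equivalence; mk⇔)
open import Function.Properties.Equivalence using () renaming (trans to ⇔-trans; sym to ⇔-sym; refl to ⇔-refl)
open import Data.Maybe using (Maybe; just; nothing)
open import Defs using (Letter; Word; CyclicShift; IsBeta)
open import Data.Empty using (⊥-elim)
open import Function using (_∘_; id)
open import Relation.Binary.PropositionalEquality
open import Relation.Binary.Definitions using (DecidableEquality)
open import Relation.Nullary using (¬_; ¬?; Dec; yes; no)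
open import Relation.Nullary.Decidable using (_×-dec_; _⊎-dec_; decidable-stable)
open import Relation.Unary using (Decidable)

module _ {A : Set} (_≟_ : DecidableEquality A) where

  unique-⊆-length : {xs ys : List A} → Unique xs → xs ⊆ ys → length xs ≤ length ys
  unique-⊆-length {[]} _ _ = z≤n
  unique-⊆-length {x ∷ xs} {ys} (x∉xs ∷ uxs) xs⊆ys = begin
      suc (length xs)           ≤⟨ s≤s (unique-⊆-length uxs xs⊆ys−x) ⟩
      suc (length (ys−x))       ≤⟨ filter-notAll (¬? ∘ (x ≟_)) ys (Any.map (λ x≡y x≢y → x≢y x≡y) (xs⊆ys (here refl))) ⟩
      length ys                 ∎
    where
    open ≤-Reasoning
    ys−x : List A
    ys−x = filter (¬? ∘ (x ≟_)) ys
    xs⊆ys−x : xs ⊆ ys−x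
    xs⊆ys−x z∈xs = ∈-filter⁺ (¬? ∘ (x ≟_)) (xs⊆ys (there z∈xs)) (All.lookup x∉xs z∈xs)

  unique-length-≡ : {xs ys : List A} → Unique xs → Unique ys → xs ⊆ ys → ys ⊆ xs → length xs ≡ length ys
  unique-length-≡ uxs uys xs⊆ys ys⊆xs = ≤-antisym (unique-⊆-length uxs xs⊆ys) (unique-⊆-length uys ys⊆xs)

  distinct-length-≡ : {xs ys : List A} → xs ⊆ ys → ys ⊆ xs →
    length (deduplicate _≟_ xs) ≡ length (deduplicate _≟_ ys)
  distinct-length-≡ {xs} {ys} xs⊆ys ys⊆xs =
    unique-length-≡ (deduplicate-! _≟_ xs) (deduplicate-! _≟_ ys) (within xs⊆ys) (within ys⊆xs)
    where
    within : {us vs : List A} → us ⊆ vs → deduplicate _≟_ us ⊆ deduplicate _≟_ vs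
    within {us} us⊆vs = ∈-deduplicate⁺ _≟_ ∘ us⊆vs ∘ ∈-deduplicate⁻ _≟_ us

module _ {A : Set} {P : A → Set} (P? : Decidable P) where

  length-filter-∁ : ∀ xs → length (filter P? xs) + length (filter (¬? ∘ P?) xs) ≡ length xs
  length-filter-∁ [] = refl
  length-filter-∁ (x ∷ xs) with P? x
  ... | yes _ = cong suc (length-filter-∁ xs)
  ... | no _ = trans (+-suc _ _) (cong suc (length-filter-∁ xs))

  length-filter-map : {B : Set} (g : B → A) → ∀ xs →
    length (filter P? (map g xs)) ≡ length (filter (P? ∘ g) xs)
  length-filter-map g [] = refl
  length-filter-map g (x ∷ xs) with P? (g x)
  ... | yes _ = cong suc (length-filter-map g xs)
  ... | no _ = length-filter-map g xs

  length-filter-split : {Q : A → Set} (Q? : Decidable Q) → ∀ xs →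
    length (filter P? xs) ≡
      length (filter (λ x → P? x ×-dec Q? x) xs) + length (filter (λ x → P? x ×-dec ¬? (Q? x)) xs)
  length-filter-split Q? [] = refl
  length-filter-split Q? (x ∷ xs) with P? x | Q? x
  ... | yes _ | yes _ = cong suc (length-filter-split Q? xs)
  ... | yes _ | no _ = trans (cong suc (length-filter-split Q? xs)) (sym (+-suc _ _))
  ... | no _ | _ = length-filter-split Q? xs

-- First occurrences.  For f : Fin n → K, `firstOcc f i` is the least index with
-- the same value as i; it is a canonical representative of the fibre of f through i.

module FirstOccurrence {K : Set} (_≟_ : DecidableEquality K) where

  firstOcc : ∀ {n} → (Fin n → K) → Fin n → Fin n
  firstOcc f fzero = fzero
  firstOcc f (fsuc i) with f fzero ≟ f (fsuc i)
  ... | yes _ = fzero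
  ... | no _ = fsuc (firstOcc (f ∘ fsuc) i)

  firstOcc-value : ∀ {n} (f : Fin n → K) i → f (firstOcc f i) ≡ f i
  firstOcc-value f fzero = refl
  firstOcc-value f (fsuc i) with f fzero ≟ f (fsuc i)
  ... | yes e = e
  ... | no _ = firstOcc-value (f ∘ fsuc) i

  firstOcc-≤ : ∀ {n} (f : Fin n → K) i → toℕ (firstOcc f i) ≤ toℕ i
  firstOcc-≤ f fzero = z≤n
  firstOcc-≤ f (fsuc i) with f fzero ≟ f (fsuc i)
  ... | yes _ = z≤n
  ... | no _ = s≤s (firstOcc-≤ (f ∘ fsuc) i)

  firstOcc-cong : ∀ {n} (f : Fin n → K) {i j} → f i ≡ f j → firstOcc f i ≡ firstOcc f j
  firstOcc-cong f {fzero} {fzero} e = refl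
  firstOcc-cong f {fzero} {fsuc j} e with f fzero ≟ f (fsuc j)
  ... | yes _ = refl
  ... | no ne = ⊥-elim (ne e)
  firstOcc-cong f {fsuc i} {fzero} e with f fzero ≟ f (fsuc i)
  ... | yes _ = refl
  ... | no ne = ⊥-elim (ne (sym e))
  firstOcc-cong f {fsuc i} {fsuc j} e with f fzero ≟ f (fsuc i) | f fzero ≟ f (fsuc j)
  ... | yes _ | yes _ = refl
  ... | no _ | no _ = cong fsuc (firstOcc-cong (f ∘ fsuc) e)
  ... | yes a | no b = ⊥-elim (b (trans a e))
  ... | no a | yes b = ⊥-elim (a (trans b (sym e)))

  firstOcc-≡⇒ : ∀ {n} (f : Fin n → K) {i j} → firstOcc f i ≡ firstOcc f j → f i ≡ f j
  firstOcc-≡⇒ f {i} {j} e = trans (sym (firstOcc-value f i)) (trans (cong f e) (firstOcc-value f j))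

  firstOcc-least : ∀ {n} (f : Fin n → K) {i j} → f i ≡ f j → toℕ (firstOcc f i) ≤ toℕ j
  firstOcc-least f {i} {j} e = subst (λ z → toℕ z ≤ toℕ j) (sym (firstOcc-cong f e)) (firstOcc-≤ f j)

  IsFirst : ∀ {n} → (Fin n → K) → Fin n → Set
  IsFirst f i = firstOcc f i ≡ i

  isFirst? : ∀ {n} (f : Fin n → K) → Decidable (IsFirst f)
  isFirst? f i = firstOcc f i ≟F i

  firstOcc-isFirst : ∀ {n} (f : Fin n → K) i → IsFirst f (firstOcc f i)
  firstOcc-isFirst f i = firstOcc-cong f (firstOcc-value f i)

  firstOcc-< : ∀ {n} (f : Fin n → K) i → ¬ IsFirst f i → toℕ (firstOcc f i) < toℕ i
  firstOcc-< f i notFirst = ≤∧≢⇒< (firstOcc-≤ f i) (notFirst ∘ toℕ-injective)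

  distinct-values : ∀ {n} (f : Fin n → K) →
    length (deduplicate _≟_ (map f (allFin n))) ≡ length (filter (isFirst? f) (allFin n))
  distinct-values {n} f = begin
      length (deduplicate _≟_ (map f (allFin n)))
        ≡⟨ unique-length-≡ _≟_ (deduplicate-! _≟_ _) unique-values
             (⊆firsts ∘ ∈-deduplicate⁻ _≟_ _) (∈-deduplicate⁺ _≟_ ∘ firsts⊆) ⟩
      length (map f firsts)                        ≡⟨ length-map f firsts ⟩
      length firsts                                ∎
    where
    open ≡-Reasoning
    firsts : List (Fin n)
    firsts = filter (isFirst? f) (allFin n)
    ⊆firsts : map f (allFin n) ⊆ map f firsts
    ⊆firsts z∈ with ∈-map⁻ f z∈
    ... | i , _ , refl = subst (_∈ map f firsts) (firstOcc-value f i)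
      (∈-map⁺ f (∈-filter⁺ (isFirst? f) (∈-allFin (firstOcc f i)) (firstOcc-isFirst f i)))
    firsts⊆ : map f firsts ⊆ map f (allFin n)
    firsts⊆ z∈ with ∈-map⁻ f z∈
    ... | i , _ , refl = ∈-map⁺ f (∈-allFin i)
    distinct-firsts : ∀ {xs} → Unique xs → All (IsFirst f) xs → AllPairs (λ i j → f i ≢ f j) xs
    distinct-firsts [] [] = []
    distinct-firsts (i∉ ∷ u) (fi ∷ fs) =
      All.zipWith (λ { (i≢j , fj) e → i≢j (trans (sym fi) (trans (firstOcc-cong f e) fj)) }) (i∉ , fs)
      ∷ distinct-firsts u fs
    unique-values : Unique (map f firsts)
    unique-values = AllPairs.map⁺ (distinct-firsts (filter⁺ (isFirst? f) (allFin⁺ n)) (all-filter (isFirst? f) (allFin n)))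

firstOcc-fibres : ∀ {K K' : Set} (_≟_ : DecidableEquality K) (_≟′_ : DecidableEquality K') {n}
  (f : Fin n → K) (g : Fin n → K') →
  (∀ {i j} → f i ≡ f j → g i ≡ g j) → (∀ {i j} → g i ≡ g j → f i ≡ f j) →
  ∀ i → FirstOccurrence.firstOcc _≟_ f i ≡ FirstOccurrence.firstOcc _≟′_ g i
firstOcc-fibres _≟_ _≟′_ f g f⇒g g⇒f fzero = refl
firstOcc-fibres _≟_ _≟′_ f g f⇒g g⇒f (fsuc i) with f fzero ≟ f (fsuc i) | g fzero ≟′ g (fsuc i)
... | yes _ | yes _ = refl
... | no _ | no _ = cong fsuc (firstOcc-fibres _≟_ _≟′_ (f ∘ fsuc) (g ∘ fsuc) f⇒g g⇒f i)
... | yes e | no ne = ⊥-elim (ne (f⇒g e))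
... | no ne | yes e = ⊥-elim (ne (g⇒f e))

least : ∀ {n} {P : Fin n → Set} → Decidable P → ∀ i → P i →
  ∃ λ c → P c × (∀ j → toℕ j < toℕ c → ¬ P j)
least {suc n} P? i Pi with P? fzero
... | yes P0 = fzero , P0 , λ _ ()
least {suc n} P? fzero Pi | no ¬P0 = ⊥-elim (¬P0 Pi)
least {suc n} {P} P? (fsuc i) Pi | no ¬P0 with least (P? ∘ fsuc) i Pi
... | c , Pc , below = fsuc c , Pc , below′
  where
  below′ : ∀ j → toℕ j < toℕ (fsuc c) → ¬ P j
  below′ fzero _ = ¬P0
  below′ (fsuc j) (s≤s j<c) = below j j<c

-- Linear algebra over GF(2) = (Bool, xor, ∧): vectors are Vec Bool n.

infixl 6 _⊕_
_⊕_ : ∀ {n} → Vec Bool n → Vec Bool n → Vec Bool n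
_⊕_ = zipWith _xor_

zeros : ∀ {n} → Vec Bool n
zeros = replicate _ false

Additive : ∀ {n} → (Vec Bool n → Bool) → Set
Additive ℓ = ∀ x y → ℓ (x ⊕ y) ≡ ℓ x xor ℓ y

NonZero : ∀ {n} → Vec Bool n → Set
NonZero x = ∃ λ i → lookup x i ≡ true

zeros-⊕ : ∀ {n} (y : Vec Bool n) → zeros ⊕ y ≡ y
zeros-⊕ [] = refl
zeros-⊕ (a ∷ y) = cong (a ∷_) (zeros-⊕ y)

additive-zeros : ∀ {n} (ℓ : Vec Bool n → Bool) → Additive ℓ → ℓ zeros ≡ false
additive-zeros ℓ ad = begin
    ℓ zeros                ≡⟨ cong ℓ (sym (zeros-⊕ zeros)) ⟩
    ℓ (zeros ⊕ zeros)      ≡⟨ ad zeros zeros ⟩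
    ℓ zeros xor ℓ zeros    ≡⟨ xor-same (ℓ zeros) ⟩
    false                  ∎
  where open ≡-Reasoning

true≢false : true ≢ false
true≢false ()

not-true : ∀ {b} → ¬ b ≡ true → b ≡ false
not-true {false} _ = refl
not-true {true} b≢true = ⊥-elim (b≢true refl)

-- Eliminating one equation: if ℓ₀ is a linear functional with ℓ₀ (1, 0, …, 0) = 1, then
-- extend y = ℓ₀ (0 ∷ y) ∷ y parametrises the kernel of ℓ₀ linearly.
module Elimination {n} (ℓ₀ : Vec Bool (suc n) → Bool) (ad₀ : Additive ℓ₀) (ℓ₀e₀ : ℓ₀ (true ∷ zeros) ≡ true) where

  extend : Vec Bool n → Vec Bool (suc n)
  extend y = ℓ₀ (false ∷ y) ∷ y

  extend-additive : ∀ y y' → extend (y ⊕ y') ≡ extend y ⊕ extend y'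
  extend-additive y y' = cong (_∷ (y ⊕ y')) (ad₀ (false ∷ y) (false ∷ y'))

  ℓ₀∘extend≡false : ∀ y → ℓ₀ (extend y) ≡ false
  ℓ₀∘extend≡false y = begin
      ℓ₀ (extend y)                   ≡⟨ cong ℓ₀ (cong₂ _∷_ (sym (xor-identityʳ a)) (sym (zeros-⊕ y))) ⟩
      ℓ₀ ((a ∷ zeros) ⊕ (false ∷ y))  ≡⟨ ad₀ (a ∷ zeros) (false ∷ y) ⟩
      ℓ₀ (a ∷ zeros) xor a            ≡⟨ cong (_xor a) (first-coordinate a) ⟩
      a xor a                         ≡⟨ xor-same a ⟩
      false                           ∎
    where
    open ≡-Reasoning
    a : Bool
    a = ℓ₀ (false ∷ y)
    first-coordinate : ∀ b → ℓ₀ (b ∷ zeros) ≡ b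
    first-coordinate true = ℓ₀e₀
    first-coordinate false = additive-zeros ℓ₀ ad₀

-- If no equation is nonzero on the first unit vector, that vector is a
-- solution; otherwise eliminate the first coordinate with one such equation ℓ₀ and
-- recurse on the remaining equations restricted to the kernel of ℓ₀.
homogeneous-solution : ∀ n (ls : List (Vec Bool n → Bool)) → All Additive ls → length ls < n →
  ∃ λ x → NonZero x × All (λ ℓ → ℓ x ≡ false) ls
homogeneous-solution zero ls ad ()
homogeneous-solution (suc n) ls ad lt with any? (λ ℓ → ℓ (true ∷ zeros) ≟B true) ls
... | no none = true ∷ zeros , (fzero , refl) , All.map not-true (¬Any⇒All¬ ls none)
... | yes some = extend y , nonzero , ─⁻ some (ℓ₀∘extend≡false y) (map⁻ y-solves)
  where
  open Elimination (Any.lookup some) (proj₁ (All.lookupAny ad some)) (lookup-result some)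
  rest : List (Vec Bool n → Bool)
  rest = map (λ ℓ y → ℓ (extend y)) (ls ─ some)
  rest-additive : All Additive rest
  rest-additive = map⁺ (All.map (λ {ℓ} adℓ y y' → trans (cong ℓ (extend-additive y y')) (adℓ (extend y) (extend y')))
                                (─⁺ some ad))
  rest-shorter : length rest < n
  rest-shorter = subst (_< n) (sym (length-map _ (ls ─ some)))
    (s≤s⁻¹ (subst (_< suc n) (length-removeAt′ ls (Any.index some)) lt))
  solution : ∃ λ y → NonZero y × All (λ ℓ → ℓ y ≡ false) rest
  solution = homogeneous-solution n rest rest-additive rest-shorter
  y : Vec Bool n
  y = proj₁ solution
  nonzero : NonZero (extend y)
  nonzero = fsuc (proj₁ (proj₁ (proj₂ solution))) , proj₂ (proj₁ (proj₂ solution))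
  y-solves : All (λ ℓ → ℓ y ≡ false) rest
  y-solves = proj₂ (proj₂ solution)

open Algebra.Properties.CommutativeSemigroup
  (CommutativeRing.+-commutativeSemigroup xor-∧-commutativeRing)
  using () renaming (interchange to xor-interchange)

xor-cancelʳ : ∀ a c → (a xor c) xor c ≡ a
xor-cancelʳ a c = trans (xor-assoc a c c) (trans (cong (a xor_) (xor-same c)) (xor-identityʳ a))

xor-≡-false : ∀ {a b} → a xor b ≡ false → a ≡ b
xor-≡-false {a} {b} e = trans (sym (xor-cancelʳ a b)) (cong (_xor b) e)

-- The potential of step labels g along a trail of n steps: at symbol s, the xor of
-- the labels of the steps before s.
potential : ∀ {n} → (Fin n → Bool) → Fin (suc n) → Bool
potential g fzero = false
potential {suc n} g (fsuc s) = g fzero xor potential (g ∘ fsuc) s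

potential-step : ∀ {n} (g : Fin n → Bool) b → potential g (fsuc b) ≡ potential g (inject₁ b) xor g b
potential-step {suc n} g fzero = xor-identityʳ (g fzero)
potential-step {suc n} g (fsuc b) =
  trans (cong (g fzero xor_) (potential-step (g ∘ fsuc) b)) (sym (xor-assoc (g fzero) _ _))

potential-step⁻ : ∀ {n} (g : Fin n → Bool) b → potential g (inject₁ b) ≡ potential g (fsuc b) xor g b
potential-step⁻ g b = trans (sym (xor-cancelʳ _ (g b))) (cong (_xor g b) (sym (potential-step g b)))

potential-cong : ∀ {n} {g g' : Fin n → Bool} → (∀ b → g b ≡ g' b) → ∀ s → potential g s ≡ potential g' s
potential-cong g≗g' fzero = refl
potential-cong {suc n} g≗g' (fsuc s) = cong₂ _xor_ (g≗g' fzero) (potential-cong (g≗g' ∘ fsuc) s)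

potential-xor : ∀ {n} (g g' : Fin n → Bool) s →
  potential (λ b → g b xor g' b) s ≡ potential g s xor potential g' s
potential-xor g g' fzero = refl
potential-xor {suc n} g g' (fsuc s) =
  trans (cong ((g fzero xor g' fzero) xor_) (potential-xor (g ∘ fsuc) (g' ∘ fsuc) s))
        (xor-interchange (g fzero) (g' fzero) _ _)

potential-vanishes : ∀ {n} (g : Fin n → Bool) s → (∀ b → toℕ b < toℕ s → g b ≡ false) → potential g s ≡ false
potential-vanishes g fzero _ = refl
potential-vanishes {suc n} g (fsuc s) before =
  cong₂ _xor_ (before fzero (s≤s z≤n)) (potential-vanishes (g ∘ fsuc) s (λ b b<s → before (fsuc b) (s≤s b<s)))

-- The condition on endpoints under which two steps of the same colour traverse
-- the same edge; it has exactly the shape of the realizability condition.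
EndsMatch : {A : Set} → Sign → Sign → A → A → A → A → Set
EndsMatch s s' x y x' y' = (s ≡ s' → x ≡ x' × y ≡ y') × (s ≢ s' → x ≡ y' × y ≡ x')

match-same : ∀ {A : Set} {s s' : Sign} {x y x' y' : A} → s ≡ s' → x ≡ x' → y ≡ y' → EndsMatch s s' x y x' y'
match-same s≡s' x≡x' y≡y' = (λ _ → x≡x' , y≡y') , (λ s≢s' → ⊥-elim (s≢s' s≡s'))

match-opposite : ∀ {A : Set} {s s' : Sign} {x y x' y' : A} → s ≢ s' → x ≡ y' → y ≡ x' → EndsMatch s s' x y x' y'
match-opposite s≢s' x≡y' y≡x' = (λ s≡s' → ⊥-elim (s≢s' s≡s')) , (λ _ → x≡y' , y≡x')

module _ {k : ℕ} {A : Set} where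

  orient : Sign → Fin k → A → A → Fin k × A × A
  orient plus c x y = c , x , y
  orient minus c x y = c , y , x

  orient-injective : ∀ s s' {c c' x y x' y'} → orient s c x y ≡ orient s' c' x' y' →
    c ≡ c' × EndsMatch s s' x y x' y'
  orient-injective plus plus refl = refl , (λ _ → refl , refl) , λ s≢s → ⊥-elim (s≢s refl)
  orient-injective minus minus refl = refl , (λ _ → refl , refl) , λ s≢s → ⊥-elim (s≢s refl)
  orient-injective plus minus refl = refl , (λ ()) , λ _ → refl , refl
  orient-injective minus plus refl = refl , (λ ()) , λ _ → refl , refl

  orient-cong : ∀ {s s' c c' x y x' y'} → s ≡ s' → c ≡ c' → x ≡ x' → y ≡ y' → orient s c x y ≡ orient s' c' x' y'
  orient-cong refl refl refl refl = refl

  orient-match : ∀ s s' {c x y x' y'} → EndsMatch s s' x y x' y' → orient s c x y ≡ orient s' c x' y'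
  orient-match plus plus (same , _) with same refl
  ... | refl , refl = refl
  orient-match minus minus (same , _) with same refl
  ... | refl , refl = refl
  orient-match plus minus (_ , opposite) with opposite (λ ())
  ... | refl , refl = refl
  orient-match minus plus (_ , opposite) with opposite (λ ())
  ... | refl , refl = refl

-- Arithmetic behind χ = e - v + 1 once e = c + a and v = 1 + a.
euler-arith : ∀ c a → + (c + a) -ℤ + suc a +ℤ + 1 ≡ + c
euler-arith c a = begin
    + (c + a) -ℤ + suc a +ℤ + 1          ≡⟨ cong₂ (λ x y → x -ℤ y +ℤ + 1) (pos-+ c a) (pos-+ 1 a) ⟩
    (+ c +ℤ + a) -ℤ (+ 1 +ℤ + a) +ℤ + 1  ≡⟨ ring (+ c) (+ a) ⟩
    + c                                  ∎
  where
  open ≡-Reasoning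
  ring : ∀ x y → (x +ℤ y) -ℤ (+ 1 +ℤ y) +ℤ + 1 ≡ x
  ring = solve-∀

-- A word of length m is a family L : Fin m → Letter k of letters;
-- for w : Word k the notions of Defs are literally the ones below at (length w, lookup w).
-- Symbols s₀ … sₘ are Fin (suc m), and step b (0-based) goes from inject₁ b to fsuc b.
-- A partition of the symbols is a labelling (same block = same label); realizability
-- and refinement make sense for labellings into any type.

module Trail {k : ℕ} (m : ℕ) (L : Fin m → Letter k) where

  Sym : Set
  Sym = Fin (suc m)

  Partition : Set
  Partition = Sym → Sym

  colour : Fin m → Fin k
  colour b = proj₁ (L b)

  sign : Fin m → Sign
  sign b = proj₂ (L b)

  Realizable : {B : Set} → (Sym → B) → Set
  Realizable p = ∀ (h l : Fin m) → colour h ≡ colour l →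
    ((sign h ≡ sign l → (p (inject₁ h) ≡ p (inject₁ l)) ⇔ (p (fsuc h) ≡ p (fsuc l)))
    × (sign h ≢ sign l → (p (inject₁ h) ≡ p (fsuc l)) ⇔ (p (fsuc h) ≡ p (inject₁ l))))

  InQ : Partition → Set
  InQ p = Realizable p × p fzero ≡ p (fromℕ m)

  PairSet : Set
  PairSet = List (Sym × Sym)

  Respects : {B : Set} → (Sym → B) → PairSet → Set
  Respects p S = ∀ {s t} → (s , t) ∈ S → p s ≡ p t

  Refines : {B C : Set} → (Sym → B) → (Sym → C) → Set
  Refines p q = ∀ s t → p s ≡ p t → q s ≡ q t

  Generates : PairSet → Partition → Set
  Generates S p = Realizable p × Respects p S × ((q : Partition) → Realizable q → Respects q S → Refines p q)

  MinGenerates : PairSet → Partition → Set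
  MinGenerates S p = Generates S p × (∀ S' → Generates S' p → length S ≤ length S')

  ContainsEnds : PairSet → Set
  ContainsEnds S = ((fzero , fromℕ m) ∈ S) ⊎ ((fromℕ m , fzero) ∈ S)

  TypeA : Partition → Set
  TypeA p = ∃[ S ] (MinGenerates S p × ContainsEnds S)

  TypeB : Partition → Set
  TypeB p = ¬ TypeA p

  Edge : Set
  Edge = Fin k × Sym × Sym

  _≟E_ : DecidableEquality Edge
  _≟E_ = ≡-dec _≟F_ (≡-dec _≟F_ _≟F_)

  edge : Partition → Fin m → Edge
  edge p b = orient (sign b) (colour b) (p (inject₁ b)) (p (fsuc b))

  numEdges : Partition → ℕ
  numEdges p = length (deduplicate _≟E_ (map (edge p) (allFin m)))

  numVertices : Partition → ℕ
  numVertices p = length (deduplicate _≟F_ (map p (allFin (suc m))))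

  χ : Partition → ℤ
  χ p = + numEdges p -ℤ + numVertices p +ℤ + 1

  -- A closing step is a new edge that does not discover a new vertex; their number,
  -- the rank, turns out to be both χ and the size of a minimum generating set.

  module V = FirstOccurrence (_≟F_ {suc m})
  module E = FirstOccurrence _≟E_

  NewVertex : Partition → Fin m → Set
  NewVertex p b = V.IsFirst p (fsuc b)

  newVertex? : (p : Partition) → Decidable (NewVertex p)
  newVertex? p b = V.isFirst? p (fsuc b)

  NewEdge : Partition → Fin m → Set
  NewEdge p = E.IsFirst (edge p)

  newEdge? : (p : Partition) → Decidable (NewEdge p)
  newEdge? p = E.isFirst? (edge p)

  Closing : Partition → Fin m → Set
  Closing p b = NewEdge p b × ¬ NewVertex p b

  closing? : (p : Partition) → Decidable (Closing p)
  closing? p b = newEdge? p b ×-dec ¬? (newVertex? p b)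

  closingSteps : Partition → List (Fin m)
  closingSteps p = filter (closing? p) (allFin m)

  rank : Partition → ℕ
  rank p = length (closingSteps p)

  firstStep : Partition → Fin m → Fin m
  firstStep p = E.firstOcc (edge p)

  firstStep-ends : ∀ p b → EndsMatch (sign (firstStep p b)) (sign b)
    (p (inject₁ (firstStep p b))) (p (fsuc (firstStep p b))) (p (inject₁ b)) (p (fsuc b))
  firstStep-ends p b = proj₂ (orient-injective (sign (firstStep p b)) (sign b) (E.firstOcc-value (edge p) b))

  -- A step along an edge traversed before cannot discover a new vertex: its target
  -- lies in the block of an endpoint of that earlier step.
  newVertex⇒newEdge : ∀ p b → NewVertex p b → NewEdge p b
  newVertex⇒newEdge p b new with newEdge? p b
  ... | yes first = first
  ... | no notFirst = ⊥-elim (<⇒≢ visited-before (cong toℕ new))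
    where
    h : Fin m
    h = firstStep p b
    h<b : toℕ h < toℕ b
    h<b = E.firstOcc-< (edge p) b notFirst
    endpoint : ∃ λ s → p (fsuc b) ≡ p s × toℕ s ≤ suc (toℕ h)
    endpoint with sign h Data.Sign.≟ sign b
    ... | yes same = fsuc h , sym (proj₂ (proj₁ (firstStep-ends p b) same)) , ≤-refl
    ... | no opposite = inject₁ h , sym (proj₁ (proj₂ (firstStep-ends p b) opposite)) ,
                         ≤-trans (≤-reflexive (toℕ-inject₁ h)) (n≤1+n _)
    visited-before : toℕ (V.firstOcc p (fsuc b)) < toℕ (fsuc b)
    visited-before = s≤s (≤-trans (V.firstOcc-least p (proj₁ (proj₂ endpoint)))
                                  (≤-trans (proj₂ (proj₂ endpoint)) h<b))

  newVertices : Partition → ℕ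
  newVertices p = length (filter (newVertex? p) (allFin m))

  -- Besides s₀, every vertex is discovered by exactly one step.
  vertex-count : ∀ p → numVertices p ≡ suc (newVertices p)
  vertex-count p = begin
      numVertices p                                           ≡⟨ V.distinct-values p ⟩
      suc (length (filter (V.isFirst? p) (tabulate fsuc)))    ≡⟨ cong (λ xs → suc (length (filter (V.isFirst? p) xs))) (sym (map-tabulate id fsuc)) ⟩
      suc (length (filter (V.isFirst? p) (map fsuc (allFin m)))) ≡⟨ cong suc (length-filter-map (V.isFirst? p) fsuc (allFin m)) ⟩
      suc (newVertices p)                                     ∎
    where open ≡-Reasoning

  -- Every edge is new at exactly one step, which either closes or discovers a vertex.
  edge-count : ∀ p → numEdges p ≡ rank p + newVertices p
  edge-count p = begin
      numEdges p                              ≡⟨ E.distinct-values (edge p) ⟩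
      length (filter (newEdge? p) (allFin m)) ≡⟨ length-filter-split (newEdge? p) (newVertex? p) (allFin m) ⟩
      length (filter discovering (allFin m)) + rank p ≡⟨ +-comm _ (rank p) ⟩
      rank p + length (filter discovering (allFin m)) ≡⟨ cong (λ n → rank p + length n)
                                                           (filter-≐ discovering (newVertex? p) (proj₂ , λ {b} new → newVertex⇒newEdge p b new , new) (allFin m)) ⟩
      rank p + newVertices p                  ∎
    where
    open ≡-Reasoning
    discovering : Decidable (λ b → NewEdge p b × NewVertex p b)
    discovering b = newEdge? p b ×-dec newVertex? p b

  χ≡rank : ∀ p → χ p ≡ + rank p
  χ≡rank p = trans (cong₂ (λ e v → + e -ℤ + v +ℤ + 1) (edge-count p) (vertex-count p)) (euler-arith (rank p) (newVertices p))

  same-edge : ∀ p {h l} → colour h ≡ colour l →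
    EndsMatch (sign h) (sign l) (p (inject₁ h)) (p (fsuc h)) (p (inject₁ l)) (p (fsuc l)) → edge p h ≡ edge p l
  same-edge p {h} {l} ce match =
    trans (orient-match (sign h) (sign l) match) (cong (λ c → orient (sign l) c (p (inject₁ l)) (p (fsuc l))) ce)

  Realizable-resp : ∀ {B C} {p : Sym → B} {q : Sym → C} → Refines p q → Refines q p → Realizable p → Realizable q
  Realizable-resp {p = p} {q} p⇒q q⇒p rp h l ce = transfer ∘ proj₁ (rp h l ce) , transfer ∘ proj₂ (rp h l ce)
    where
    transfer : ∀ {a b c d} → (p a ≡ p b) ⇔ (p c ≡ p d) → (q a ≡ q b) ⇔ (q c ≡ q d)
    transfer e = mk⇔ (p⇒q _ _ ∘ Equivalence.to e ∘ q⇒p _ _) (p⇒q _ _ ∘ Equivalence.from e ∘ q⇒p _ _)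

  Generates-resp : ∀ {S p q} → Refines p q → Refines q p → Generates S p → Generates S q
  Generates-resp p⇒q q⇒p (rp , resp , finest) =
    Realizable-resp p⇒q q⇒p rp , p⇒q _ _ ∘ resp , λ r rr respr s t e → finest r rr respr s t (q⇒p s t e)

  TypeA-resp : ∀ {p q} → Refines p q → Refines q p → TypeA p → TypeA q
  TypeA-resp p⇒q q⇒p (S , (gen , minimal) , ends) =
    S , (Generates-resp p⇒q q⇒p gen , λ S' gen' → minimal S' (Generates-resp q⇒p p⇒q gen')) , ends

  edge-resp : ∀ {p q} → Refines p q → ∀ {h l} → edge p h ≡ edge p l → edge q h ≡ edge q l
  edge-resp {p} {q} p⇒q {h} {l} e with orient-injective (sign h) (sign l) e
  ... | ce , same , opposite = same-edge q ce (both ∘ same , both ∘ opposite)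
    where
    both : ∀ {a b c d} → p a ≡ p b × p c ≡ p d → q a ≡ q b × q c ≡ q d
    both (e₁ , e₂) = p⇒q _ _ e₁ , p⇒q _ _ e₂

  rank-resp : ∀ {p q} → Refines p q → Refines q p → rank p ≡ rank q
  rank-resp {p} {q} p⇒q q⇒p = cong length (filter-≐ (closing? p) (closing? q) (transfer p⇒q q⇒p , transfer q⇒p p⇒q) (allFin m))
    where
    transfer : ∀ {p q} → Refines p q → Refines q p → ∀ {b} → Closing p b → Closing q b
    transfer {p} {q} p⇒q q⇒p {b} (newE , oldV) =
      trans (sym (firstOcc-fibres _≟E_ _≟E_ (edge p) (edge q) (edge-resp p⇒q) (edge-resp q⇒p) b)) newE ,
      oldV ∘ trans (firstOcc-fibres _≟F_ _≟F_ p q (p⇒q _ _) (q⇒p _ _) (fsuc b))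

  -- Upper bound: the closing pairs (target of a closing step, first symbol of its block)
  -- generate p.

  closingPairs : Partition → PairSet
  closingPairs p = map (λ b → fsuc b , V.firstOcc p (fsuc b)) (closingSteps p)

  -- If q is realizable and identifies the closing pairs of p, every symbol is q-equivalent
  -- to the first symbol of its p-block.  Induction along the trail: the target of step b
  -- is new, or closes (a closing pair), or follows an edge first traversed by an earlier
  -- step h, and then realizability of q transports the claim from the ends of h.
  module _ {p q : Partition} (rq : Realizable q) (respects : Respects q (closingPairs p)) where

    toFirst : ∀ s → Acc _<F_ s → q s ≡ q (V.firstOcc p s)
    toFirst fzero _ = refl
    toFirst (fsuc b) (acc below) with newVertex? p b | newEdge? p b
    ... | yes new | _ = cong q (sym new)
    ... | no old | yes newE = respects (∈-map⁺ _ (∈-filter⁺ (closing? p) (∈-allFin b) (newE , old)))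
    ... | no old | no oldE = forced
      where
      ih : ∀ s → toℕ s ≤ toℕ b → q s ≡ q (V.firstOcc p s)
      ih s s≤b = toFirst s (below (s≤s s≤b))
      same-block : ∀ {s t} → toℕ s ≤ toℕ b → toℕ t ≤ toℕ b → p s ≡ p t → q s ≡ q t
      same-block s≤b t≤b e = trans (ih _ s≤b) (trans (cong q (V.firstOcc-cong p e)) (sym (ih _ t≤b)))
      h : Fin m
      h = firstStep p b
      h<b : toℕ h < toℕ b
      h<b = E.firstOcc-< (edge p) b oldE
      src-h≤b : toℕ (inject₁ h) ≤ toℕ b
      src-h≤b = ≤-trans (≤-reflexive (toℕ-inject₁ h)) (<⇒≤ h<b)
      src-b≤b : toℕ (inject₁ b) ≤ toℕ b
      src-b≤b = ≤-reflexive (toℕ-inject₁ b)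
      realizable-hb = rq h b (proj₁ (orient-injective (sign h) (sign b) (E.firstOcc-value (edge p) b)))
      forced : q (fsuc b) ≡ q (V.firstOcc p (fsuc b))
      forced with sign h Data.Sign.≟ sign b
      ... | yes same = let (src≡ , tgt≡) = proj₁ (firstStep-ends p b) same in
        trans (sym (Equivalence.to (proj₁ realizable-hb same) (same-block src-h≤b src-b≤b src≡)))
              (trans (ih (fsuc h) h<b) (cong q (V.firstOcc-cong p tgt≡)))
      ... | no opposite = let (src≡tgt , tgt≡src) = proj₂ (firstStep-ends p b) opposite in
        trans (sym (Equivalence.from (proj₂ realizable-hb opposite) (same-block h<b src-b≤b tgt≡src)))
              (trans (ih (inject₁ h) src-h≤b) (cong q (V.firstOcc-cong p src≡tgt)))

  closingPairs-generate : ∀ p → Realizable p → Generates (closingPairs p) p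
  closingPairs-generate p rp = rp , respects , finest
    where
    respects : Respects p (closingPairs p)
    respects st∈ with ∈-map⁻ _ st∈
    ... | b , _ , refl = sym (V.firstOcc-value p (fsuc b))
    finest : (q : Partition) → Realizable q → Respects q (closingPairs p) → Refines p q
    finest q rq respq s t e = trans (toFirst rq respq s (<-wellFounded s))
      (trans (cong q (V.firstOcc-cong p e)) (sym (toFirst rq respq t (<-wellFounded t))))

  -- Lower bound, by linear algebra over GF(2).  Labels x on the steps that vanish off the
  -- closing steps, copied to every step from the first traversal of its edge, have a
  -- potential that refines p into a realizable partition.  If S generates p with fewer than
  -- rank p pairs, such a nonzero x can be chosen constant on the pairs of S; the refinement
  -- then still respects S, so p refines it — which the first step with x = 1 forbids.

  -- Refining a realizable partition by the potential of step labels that only depend on the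
  -- edge keeps it realizable: along steps traversing the same edge the potential changes alike.
  refine-realizable : ∀ {p} (g : Fin m → Bool) → Realizable p → (∀ {h l} → edge p h ≡ edge p l → g h ≡ g l) →
    Realizable (λ s → p s , potential g s)
  refine-realizable {p} g rp g-edge h l ce = same , opposite
    where
    f : Sym → Bool
    f = potential g
    κ : Sym → Sym × Bool
    κ s = p s , f s
    realizable-hl = rp h l ce
    both : ∀ {a b a' b' c c' : Bool} → a ≡ b xor c → a' ≡ b' xor c' → b ≡ b' → c ≡ c' → a ≡ a'
    both ea ea' eb ec = trans ea (trans (cong₂ _xor_ eb ec) (sym ea'))
    same : sign h ≡ sign l → (κ (inject₁ h) ≡ κ (inject₁ l)) ⇔ (κ (fsuc h) ≡ κ (fsuc l))
    same es = mk⇔ to from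
      where
      R = proj₁ realizable-hl es
      to : κ (inject₁ h) ≡ κ (inject₁ l) → κ (fsuc h) ≡ κ (fsuc l)
      to e = let (ps , fs) = ,-injective e ; pt = Equivalence.to R ps
                 gs = g-edge (same-edge p ce (match-same es ps pt))
             in cong₂ _,_ pt (both (potential-step g h) (potential-step g l) fs gs)
      from : κ (fsuc h) ≡ κ (fsuc l) → κ (inject₁ h) ≡ κ (inject₁ l)
      from e = let (pt , ft) = ,-injective e ; ps = Equivalence.from R pt
                   gs = g-edge (same-edge p ce (match-same es ps pt))
               in cong₂ _,_ ps (both (potential-step⁻ g h) (potential-step⁻ g l) ft gs)
    opposite : sign h ≢ sign l → (κ (inject₁ h) ≡ κ (fsuc l)) ⇔ (κ (fsuc h) ≡ κ (inject₁ l))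
    opposite ne = mk⇔ to from
      where
      R = proj₂ realizable-hl ne
      to : κ (inject₁ h) ≡ κ (fsuc l) → κ (fsuc h) ≡ κ (inject₁ l)
      to e = let (p₁ , f₁) = ,-injective e ; p₂ = Equivalence.to R p₁
                 gs = g-edge (same-edge p ce (match-opposite ne p₁ p₂))
             in cong₂ _,_ p₂ (both (potential-step g h) (potential-step⁻ g l) f₁ gs)
      from : κ (fsuc h) ≡ κ (inject₁ l) → κ (inject₁ h) ≡ κ (fsuc l)
      from e = let (p₂ , f₂) = ,-injective e ; p₁ = Equivalence.from R p₂
                   gs = g-edge (same-edge p ce (match-opposite ne p₁ p₂))
               in cong₂ _,_ p₁ (both (potential-step⁻ g h) (potential-step g l) f₂ gs)

  edgeLabels : Partition → (Fin m → Bool) → Fin m → Bool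
  edgeLabels p x b = x (firstStep p b)

  -- If x vanishes off the closing steps and the potential of its edge labels is constant on
  -- the blocks of p, then x vanishes: at the first step c with x c = 1, a closing step, the
  -- potential jumps from 0 to 1, while the target of c lies in the block of an earlier
  -- symbol, where the potential is still 0.
  cycle-labels-vanish : ∀ p (x : Fin m → Bool) → (∀ b → ¬ Closing p b → x b ≡ false) →
    Refines p (potential (edgeLabels p x)) → ∀ b → x b ≡ false
  cycle-labels-vanish p x off-closing constant b with x b ≟B true
  ... | no xb≢true = not-true xb≢true
  ... | yes xb = ⊥-elim (true≢false (begin
      true                   ≡⟨ sym jump ⟩
      f (fsuc c)             ≡⟨ constant (fsuc c) j₀ (sym (V.firstOcc-value p (fsuc c))) ⟩
      f j₀                   ≡⟨ quiet j₀ j₀≤c ⟩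
      false                  ∎))
    where
    open ≡-Reasoning
    f : Sym → Bool
    f = potential (edgeLabels p x)
    first-one : ∃ λ c → x c ≡ true × (∀ j → toℕ j < toℕ c → ¬ x j ≡ true)
    first-one = least (λ i → x i ≟B true) b xb
    c : Fin m
    c = proj₁ first-one
    xc : x c ≡ true
    xc = proj₁ (proj₂ first-one)
    closing-c : Closing p c
    closing-c = decidable-stable (closing? p c) (λ nc → true≢false (trans (sym xc) (off-closing c nc)))
    quiet : ∀ s → toℕ s ≤ toℕ c → f s ≡ false
    quiet s s≤c = potential-vanishes _ s λ b' b'<s →
      not-true (proj₂ (proj₂ first-one) (firstStep p b') (≤-<-trans (E.firstOcc-≤ (edge p) b') (<-≤-trans b'<s s≤c)))
    jump : f (fsuc c) ≡ true
    jump = begin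
      f (fsuc c)                           ≡⟨ potential-step (edgeLabels p x) c ⟩
      f (inject₁ c) xor x (firstStep p c) ≡⟨ cong₂ _xor_ (quiet (inject₁ c) (≤-reflexive (toℕ-inject₁ c))) (cong x (proj₁ closing-c)) ⟩
      false xor x c                        ≡⟨ xc ⟩
      true                                 ∎
    j₀ : Sym
    j₀ = V.firstOcc p (fsuc c)
    j₀≤c : toℕ j₀ ≤ toℕ c
    j₀≤c = s≤s⁻¹ (V.firstOcc-< p (fsuc c) (proj₂ closing-c))

  edgePotential : Partition → Vec Bool m → Sym → Bool
  edgePotential p x = potential (edgeLabels p (lookup x))

  edgePotential-additive : ∀ p x y s → edgePotential p (x ⊕ y) s ≡ edgePotential p x s xor edgePotential p y s
  edgePotential-additive p x y s =
    trans (potential-cong (λ b → lookup-zipWith _xor_ (firstStep p b) x y) s) (potential-xor _ _ s)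

  -- If S generates p and the edge potential of x agrees on the pairs of S, it is constant
  -- on the blocks of p: refining p by it gives a realizable partition respecting S.
  generated-constant : ∀ {S p} → Generates S p → ∀ x →
    (∀ {s t} → (s , t) ∈ S → edgePotential p x s ≡ edgePotential p x t) → Refines p (edgePotential p x)
  generated-constant {S} {p} (rp , respS , finest) x agrees s t e =
    proj₂ (,-injective (K.firstOcc-≡⇒ κ {s} {t} (finest q realizable-q respects-q s t e)))
    where
    κ : Sym → Sym × Bool
    κ s = p s , edgePotential p x s
    module K = FirstOccurrence (≡-dec _≟F_ _≟B_)
    q : Partition
    q = K.firstOcc κ
    realizable-q : Realizable q
    realizable-q = Realizable-resp {p = κ} {q = q} (λ s t → K.firstOcc-cong κ {s} {t}) (λ s t → K.firstOcc-≡⇒ κ {s} {t})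
      (refine-realizable {p = p} (edgeLabels p (lookup x)) rp (cong (lookup x) ∘ E.firstOcc-cong (edge p)))
    respects-q : Respects q S
    respects-q st∈ = K.firstOcc-cong κ (cong₂ _,_ (respS st∈) (agrees st∈))

  nonClosingSteps : Partition → List (Fin m)
  nonClosingSteps p = filter (¬? ∘ closing? p) (allFin m)

  coordinate : Fin m → Vec Bool m → Bool
  coordinate b x = lookup x b

  pairEquation : Partition → Sym × Sym → Vec Bool m → Bool
  pairEquation p st x = edgePotential p x (proj₁ st) xor edgePotential p x (proj₂ st)

  equations : Partition → PairSet → List (Vec Bool m → Bool)
  equations p S = map coordinate (nonClosingSteps p) ++ map (pairEquation p) S

  equations-additive : ∀ p S → All Additive (equations p S)
  equations-additive p S =
    ++⁺ (map⁺ {xs = nonClosingSteps p} (All.tabulate λ {b} _ x y → lookup-zipWith _xor_ b x y))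
        (map⁺ {xs = S} (All.tabulate λ {st} _ x y →
          trans (cong₂ _xor_ (edgePotential-additive p x y (proj₁ st)) (edgePotential-additive p x y (proj₂ st)))
                (xor-interchange (edgePotential p x (proj₁ st)) _ _ _)))

  equations-length : ∀ p S → length (equations p S) ≡ length (nonClosingSteps p) + length S
  equations-length p S = trans (length-++ (map coordinate (nonClosingSteps p)))
    (cong₂ _+_ (length-map coordinate (nonClosingSteps p)) (length-map (pairEquation p) S))

  nonClosing-length : ∀ p → length (nonClosingSteps p) + rank p ≡ m
  nonClosing-length p = trans (+-comm _ (rank p)) (trans (length-filter-∁ (closing? p) (allFin m)) (length-tabulate id))

  -- Lower bound: every generating set has at least rank p pairs.  Otherwise the system has
  -- fewer equations than unknowns, and a nonzero solution contradicts cycle-labels-vanish.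
  rank≤generators : ∀ {S p} → Generates S p → rank p ≤ length S
  rank≤generators {S} {p} gen with rank p ≤? length S
  ... | yes r≤S = r≤S
  ... | no r≰S = ⊥-elim (true≢false (trans (sym xi) (cycle-labels-vanish p (lookup x) off-closing constant i)))
    where
    fewer : length (equations p S) < m
    fewer = begin-strict
      length (equations p S)             ≡⟨ equations-length p S ⟩
      length (nonClosingSteps p) + length S  <⟨ +-monoʳ-< (length (nonClosingSteps p)) (≰⇒> r≰S) ⟩
      length (nonClosingSteps p) + rank p    ≡⟨ nonClosing-length p ⟩
      m                                      ∎
      where open ≤-Reasoning
    solution : ∃ λ x → NonZero x × All (λ ℓ → ℓ x ≡ false) (equations p S)
    solution = homogeneous-solution m (equations p S) (equations-additive p S) fewer
    x : Vec Bool m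
    x = proj₁ solution
    i : Fin m
    i = proj₁ (proj₁ (proj₂ solution))
    xi : lookup x i ≡ true
    xi = proj₂ (proj₁ (proj₂ solution))
    solves : All (λ ℓ → ℓ x ≡ false) (map coordinate (nonClosingSteps p)) × All (λ ℓ → ℓ x ≡ false) (map (pairEquation p) S)
    solves = ++⁻ (map coordinate (nonClosingSteps p)) (proj₂ (proj₂ solution))
    off-closing : ∀ b → ¬ Closing p b → lookup x b ≡ false
    off-closing b nc = All.lookup (map⁻ (proj₁ solves)) (∈-filter⁺ (¬? ∘ closing? p) (∈-allFin b) nc)
    constant : Refines p (edgePotential p x)
    constant = generated-constant gen x (xor-≡-false ∘ All.lookup (map⁻ (proj₂ solves)))

  minGenerates⇔ : ∀ {S p} → MinGenerates S p ⇔ (Generates S p × length S ≤ rank p)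
  minGenerates⇔ {S} {p} = mk⇔ to from
    where
    to : MinGenerates S p → Generates S p × length S ≤ rank p
    to (gen , minimal) = gen , subst (length S ≤_) (length-map _ (closingSteps p))
                                 (minimal (closingPairs p) (closingPairs-generate p (proj₁ gen)))
    from : Generates S p × length S ≤ rank p → MinGenerates S p
    from (gen , S≤rank) = gen , λ S' gen' → ≤-trans S≤rank (rank≤generators gen')

-- Moving the last letter of a word w = x a to the front gives w' = a x (n = length x).
-- Step j of w' is step rot j of w.  On symbols, σ sends those of w' to those of w
-- (t₀ ↦ sₙ, t_{j+1} ↦ s_j) and τ sends those of w to those of w' (s_j ↦ t_{j+1} for
-- j ≤ n, and s_{n+1} ↦ t₁); they are mutually inverse once the two ends of each trail
-- are identified.

rot : ∀ {n} → Fin (suc n) → Fin (suc n)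
rot {n} fzero = fromℕ n
rot (fsuc i) = inject₁ i

inject₁-or-last : ∀ {m} (s : Fin (suc m)) → (∃ λ i → s ≡ inject₁ i) ⊎ s ≡ fromℕ m
inject₁-or-last {m} s with m ≟ℕ toℕ s
... | yes m≡s = inj₂ (toℕ-injective (trans (sym m≡s) (sym (toℕ-fromℕ m))))
... | no m≢s = inj₁ (lower₁ s m≢s , sym (inject₁-lower₁ s m≢s))

rot-surjective : ∀ {n} (i : Fin (suc n)) → ∃ λ j → rot j ≡ i
rot-surjective i with inject₁-or-last i
... | inj₁ (i' , refl) = fsuc i' , refl
... | inj₂ refl = fzero , refl

σ : ∀ {n} → Fin (suc (suc n)) → Fin (suc (suc n))
σ {n} fzero = inject₁ (fromℕ n)
σ (fsuc j) = inject₁ j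

τ : ∀ {n} → Fin (suc (suc n)) → Fin (suc (suc n))
τ s with inject₁-or-last s
... | inj₁ (j , _) = fsuc j
... | inj₂ _ = fsuc fzero

τ-inject₁ : ∀ {n} (j : Fin (suc n)) → τ (inject₁ j) ≡ fsuc j
τ-inject₁ j with inject₁-or-last (inject₁ j)
... | inj₁ (j' , e) = cong fsuc (inject₁-injective (sym e))
... | inj₂ e = ⊥-elim (fromℕ≢inject₁ (sym e))

τ-last : ∀ n → τ (fromℕ (suc n)) ≡ fsuc fzero
τ-last n with inject₁-or-last (fromℕ (suc n))
... | inj₁ (j , e) = ⊥-elim (fromℕ≢inject₁ e)
... | inj₂ _ = refl

¬-⇔ : ∀ {A B : Set} → A ⇔ B → (¬ A) ⇔ (¬ B)
¬-⇔ A⇔B = mk⇔ (λ ¬A → ¬A ∘ Equivalence.from A⇔B) (λ ¬B → ¬B ∘ Equivalence.to A⇔B)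

⇔-subst : ∀ {A : Set} {a b c d a' b' c' d' : A} → a ≡ a' → b ≡ b' → c ≡ c' → d ≡ d' →
  (a ≡ b ⇔ c ≡ d) → (a' ≡ b' ⇔ c' ≡ d')
⇔-subst refl refl refl refl e = e

Corresponding : ∀ {k} m (L : Fin m → Letter k) m' (L' : Fin m' → Letter k) → Set
Corresponding m L m' L' =
    (∀ p → T.InQ p → ∃ λ p' → T'.InQ p' × (T.TypeB p ⇔ T'.TypeB p') × T.rank p ≡ T'.rank p')
  × (∀ p' → T'.InQ p' → ∃ λ p → T.InQ p × (T.TypeB p ⇔ T'.TypeB p') × T.rank p ≡ T'.rank p')
  where
  module T = Trail m L
  module T' = Trail m' L'

module Rotation {k : ℕ} (n : ℕ) (L L' : Fin (suc n) → Letter k) (rotated : ∀ j → L' j ≡ L (rot j)) where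

  module W = Trail (suc n) L
  module W' = Trail (suc n) L'

  Sym : Set
  Sym = Fin (suc (suc n))

  last : Sym
  last = fromℕ (suc n)

  Closed : {B : Set} → (Sym → B) → Set
  Closed p = p fzero ≡ p last

  colour-rot : ∀ j → W'.colour j ≡ W.colour (rot j)
  colour-rot j = cong proj₁ (rotated j)

  sign-rot : ∀ j → W'.sign j ≡ W.sign (rot j)
  sign-rot j = cong proj₂ (rotated j)

  Matches : {B : Set} → (Sym → B) → (Sym → B) → Set
  Matches P P' = ∀ j → P' (inject₁ j) ≡ P (inject₁ (rot j)) × P' (fsuc j) ≡ P (fsuc (rot j))

  matches-σ : ∀ {B} (p : Sym → B) → Closed p → Matches p (p ∘ σ)
  matches-σ p closed fzero = refl , closed
  matches-σ p closed (fsuc i) = refl , refl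

  matches-τ : ∀ {B} (q : Sym → B) → Closed q → Matches (q ∘ τ) q
  matches-τ q closed fzero = trans closed (cong q (sym (τ-inject₁ (fromℕ n)))) , cong q (sym (τ-last n))
  matches-τ q closed (fsuc i) = cong q (sym (τ-inject₁ (inject₁ i))) , cong q (sym (τ-inject₁ (fsuc i)))

  τ∘σ : ∀ {B} (q : Sym → B) → Closed q → ∀ t → q (τ (σ t)) ≡ q t
  τ∘σ q closed fzero = trans (cong q (τ-inject₁ (fromℕ n))) (sym closed)
  τ∘σ q closed (fsuc i) = cong q (τ-inject₁ i)

  σ∘τ : ∀ {B} (p : Sym → B) → Closed p → ∀ s → p (σ (τ s)) ≡ p s
  σ∘τ p closed s = [ inner , outer ]′ (inject₁-or-last s)
    where
    inner : (∃ λ i → s ≡ inject₁ i) → p (σ (τ s)) ≡ p s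
    inner (i , refl) = cong (p ∘ σ) (τ-inject₁ i)
    outer : s ≡ last → p (σ (τ s)) ≡ p s
    outer refl = trans (cong (p ∘ σ) (τ-last n)) closed

  realizable-matches : ∀ {B} (P P' : Sym → B) → Matches P P' → W.Realizable P ⇔ W'.Realizable P'
  realizable-matches P P' match = mk⇔ to from
    where
    to : W.Realizable P → W'.Realizable P'
    to rP h l ce' =
        (λ es' → ⇔-subst (sym (src h)) (sym (src l)) (sym (tgt h)) (sym (tgt l))
                    (proj₁ R (trans (sym (sign-rot h)) (trans es' (sign-rot l)))))
      , (λ ne' → ⇔-subst (sym (src h)) (sym (tgt l)) (sym (tgt h)) (sym (src l))
                    (proj₂ R (λ es → ne' (trans (sign-rot h) (trans es (sym (sign-rot l)))))))
      where
      src = proj₁ ∘ match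
      tgt = proj₂ ∘ match
      R = rP (rot h) (rot l) (trans (sym (colour-rot h)) (trans ce' (colour-rot l)))
    from : W'.Realizable P' → W.Realizable P
    from rP' h l ce with rot-surjective h | rot-surjective l
    ... | h' , refl | l' , refl =
        (λ es → ⇔-subst (src h') (src l') (tgt h') (tgt l')
                   (proj₁ R (trans (sign-rot h') (trans es (sym (sign-rot l'))))))
      , (λ ne → ⇔-subst (src h') (tgt l') (tgt h') (src l')
                   (proj₂ R (λ es' → ne (trans (sym (sign-rot h')) (trans es' (sign-rot l'))))))
      where
      src = proj₁ ∘ match
      tgt = proj₂ ∘ match
      R = rP' h' l' (trans (colour-rot h') (trans ce (sym (colour-rot l'))))

  edge-matches : ∀ (p p' : Sym → Sym) → Matches p p' → ∀ j → W'.edge p' j ≡ W.edge p (rot j)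
  edge-matches p p' match j = orient-cong (sign-rot j) (colour-rot j) (proj₁ (match j)) (proj₂ (match j))

  numEdges-matches : ∀ (p p' : Sym → Sym) → Matches p p' → W.numEdges p ≡ W'.numEdges p'
  numEdges-matches p p' match = distinct-length-≡ W._≟E_ ⊆′ ⊇′
    where
    ⊆′ : map (W.edge p) (allFin (suc n)) ⊆ map (W'.edge p') (allFin (suc n))
    ⊆′ e∈ with ∈-map⁻ (W.edge p) e∈
    ... | i , _ , refl with rot-surjective i
    ...   | j , refl = subst (_∈ map (W'.edge p') (allFin (suc n))) (edge-matches p p' match j) (∈-map⁺ (W'.edge p') (∈-allFin j))
    ⊇′ : map (W'.edge p') (allFin (suc n)) ⊆ map (W.edge p) (allFin (suc n))
    ⊇′ e∈ with ∈-map⁻ (W'.edge p') e∈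
    ... | j , _ , refl = subst (_∈ map (W.edge p) (allFin (suc n))) (sym (edge-matches p p' match j)) (∈-map⁺ (W.edge p) (∈-allFin (rot j)))

  numVertices-σ : ∀ p → Closed p → W.numVertices p ≡ W'.numVertices (p ∘ σ)
  numVertices-σ p closed = distinct-length-≡ _≟F_ ⊆′ ⊇′
    where
    ⊆′ : map p (allFin (suc (suc n))) ⊆ map (p ∘ σ) (allFin (suc (suc n)))
    ⊆′ v∈ with ∈-map⁻ p v∈
    ... | s , _ , refl = subst (_∈ map (p ∘ σ) (allFin (suc (suc n)))) (σ∘τ p closed s) (∈-map⁺ (p ∘ σ) (∈-allFin (τ s)))
    ⊇′ : map (p ∘ σ) (allFin (suc (suc n))) ⊆ map p (allFin (suc (suc n)))
    ⊇′ v∈ with ∈-map⁻ (p ∘ σ) {xs = allFin (suc (suc n))} v∈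
    ... | t , _ , refl = ∈-map⁺ p (∈-allFin (σ t))

  -- Hence χ, and so the rank, is the same for a closed partition of w and its image on w'.
  rank-σ : ∀ p → Closed p → W.rank p ≡ W'.rank (p ∘ σ)
  rank-σ p closed = +-injective (begin
    + W.rank p          ≡⟨ sym (W.χ≡rank p) ⟩
    W.χ p               ≡⟨ cong₂ (λ e v → + e -ℤ + v +ℤ + 1) (numEdges-matches p (p ∘ σ) (matches-σ p closed)) (numVertices-σ p closed) ⟩
    W'.χ (p ∘ σ)        ≡⟨ W'.χ≡rank (p ∘ σ) ⟩
    + W'.rank (p ∘ σ)   ∎)
    where open ≡-Reasoning

  -- Pairs of symbols are moved along a map f, except the end pair (s₀, last), which is
  -- the end pair of both words and is kept.
  EndPair : Sym × Sym → Set
  EndPair st = st ≡ (fzero , last) ⊎ st ≡ (last , fzero)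

  endPair? : ∀ st → Dec (EndPair st)
  endPair? st = ≡-dec _≟F_ _≟F_ st (fzero , last) ⊎-dec ≡-dec _≟F_ _≟F_ st (last , fzero)

  movePair : (Sym → Sym) → Sym × Sym → Sym × Sym
  movePair f st with endPair? st
  ... | yes _ = st
  ... | no _ = f (proj₁ st) , f (proj₂ st)

  movePair-cases : ∀ f st → (EndPair st × movePair f st ≡ st) ⊎ movePair f st ≡ (f (proj₁ st) , f (proj₂ st))
  movePair-cases f st with endPair? st
  ... | yes end = inj₁ (end , refl)
  ... | no _ = inj₂ refl

  closed-end : ∀ {B} (r : Sym → B) → Closed r → ∀ {s t} → EndPair (s , t) → r s ≡ r t
  closed-end r closed (inj₁ refl) = closed
  closed-end r closed (inj₂ refl) = sym closed

  respects-move : ∀ {B} (r : Sym → B) f S → Closed r → (∀ {s t} → (s , t) ∈ S → r (f s) ≡ r (f t)) →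
    W.Respects r (map (movePair f) S)
  respects-move r f S closed respects st∈ with ∈-map⁻ (movePair f) st∈
  ... | (s , t) , st∈S , refl with movePair-cases f (s , t)
  ...   | inj₁ (end , kept) = subst (λ uv → r (proj₁ uv) ≡ r (proj₂ uv)) (sym kept) (closed-end r closed end)
  ...   | inj₂ moved = subst (λ uv → r (proj₁ uv) ≡ r (proj₂ uv)) (sym moved) (respects st∈S)

  respects-unmove : ∀ {B} (r : Sym → B) f S → r (f fzero) ≡ r (f last) → W.Respects r (map (movePair f) S) →
    ∀ {s t} → (s , t) ∈ S → r (f s) ≡ r (f t)
  respects-unmove r f S closed∘f respects {s} {t} st∈S with movePair-cases f (s , t)
  ... | inj₁ (end , _) = closed-end (r ∘ f) closed∘f end
  ... | inj₂ moved = respects (subst (_∈ map (movePair f) S) moved (∈-map⁺ (movePair f) st∈S))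

  movePair-end : ∀ f {st} → EndPair st → movePair f st ≡ st
  movePair-end f {st} end with endPair? st
  ... | yes _ = refl
  ... | no notEnd = ⊥-elim (notEnd end)

  ends-move : ∀ f S → W.ContainsEnds S → W.ContainsEnds (map (movePair f) S)
  ends-move f S (inj₁ end∈) = inj₁ (subst (_∈ map (movePair f) S) (movePair-end f (inj₁ refl)) (∈-map⁺ (movePair f) end∈))
  ends-move f S (inj₂ end∈) = inj₂ (subst (_∈ map (movePair f) S) (movePair-end f (inj₂ refl)) (∈-map⁺ (movePair f) end∈))

  ends-closed : ∀ {B} (r : Sym → B) S → W.Respects r S → W.ContainsEnds S → Closed r
  ends-closed r S respects (inj₁ end∈) = respects end∈
  ends-closed r S respects (inj₂ end∈) = sym (respects end∈)

  generates-τ : ∀ {S p} → Closed p → W.ContainsEnds S → W.Generates S p → W'.Generates (map (movePair τ) S) (p ∘ σ)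
  generates-τ {S} {p} closed ends (rp , respS , finest) = rp' , respS' , finest'
    where
    rp' : W'.Realizable (p ∘ σ)
    rp' = Equivalence.to (realizable-matches p (p ∘ σ) (matches-σ p closed)) rp
    respS' : W.Respects (p ∘ σ) (map (movePair τ) S)
    respS' = respects-move (p ∘ σ) τ S refl
      (λ {s} {t} st∈ → trans (σ∘τ p closed s) (trans (respS st∈) (sym (σ∘τ p closed t))))
    finest' : (q' : Sym → Sym) → W'.Realizable q' → W.Respects q' (map (movePair τ) S) → W.Refines (p ∘ σ) q'
    finest' q' rq' respq' s t e =
      trans (sym (τ∘σ q' closed' s)) (trans (finest (q' ∘ τ) rq respq (σ s) (σ t) e) (τ∘σ q' closed' t))
      where
      closed' : Closed q'
      closed' = ends-closed q' _ respq' (ends-move τ S ends)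
      rq : W.Realizable (q' ∘ τ)
      rq = Equivalence.from (realizable-matches (q' ∘ τ) q' (matches-τ q' closed')) rq'
      respq : W.Respects (q' ∘ τ) S
      respq = respects-unmove q' τ S (trans (cong q' (τ-inject₁ fzero)) (cong q' (sym (τ-last n)))) respq'

  generates-σ : ∀ {S' p} → Closed p → W.ContainsEnds S' → W'.Generates S' (p ∘ σ) → W.Generates (map (movePair σ) S') p
  generates-σ {S'} {p} closed ends (rp' , respS' , finest') = rp , respS , finest
    where
    rp : W.Realizable p
    rp = Equivalence.from (realizable-matches p (p ∘ σ) (matches-σ p closed)) rp'
    respS : W.Respects p (map (movePair σ) S')
    respS = respects-move p σ S' closed respS'
    finest : (q : Sym → Sym) → W.Realizable q → W.Respects q (map (movePair σ) S') → W.Refines p q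
    finest q rq respq s t e = trans (sym (σ∘τ q closedq s)) (trans (finest' (q ∘ σ) rq' respq' (τ s) (τ t) e') (σ∘τ q closedq t))
      where
      closedq : Closed q
      closedq = ends-closed q _ respq (ends-move σ S' ends)
      rq' : W'.Realizable (q ∘ σ)
      rq' = Equivalence.to (realizable-matches q (q ∘ σ) (matches-σ q closedq)) rq
      respq' : W.Respects (q ∘ σ) S'
      respq' = respects-unmove q σ S' refl respq
      e' : p (σ (τ s)) ≡ p (σ (τ t))
      e' = trans (σ∘τ p closed s) (trans e (sym (σ∘τ p closed t)))

  typeA-σ : ∀ {p} → Closed p → W.TypeA p ⇔ W'.TypeA (p ∘ σ)
  typeA-σ {p} closed = mk⇔ to from
    where
    to : W.TypeA p → W'.TypeA (p ∘ σ)
    to (S , min , ends) with Equivalence.to W.minGenerates⇔ min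
    ... | gen , S≤rank = map (movePair τ) S ,
      Equivalence.from W'.minGenerates⇔
        (generates-τ closed ends gen , subst₂ _≤_ (sym (length-map _ S)) (rank-σ p closed) S≤rank) ,
      ends-move τ S ends
    from : W'.TypeA (p ∘ σ) → W.TypeA p
    from (S' , min' , ends') with Equivalence.to W'.minGenerates⇔ min'
    ... | gen' , S'≤rank = map (movePair σ) S' ,
      Equivalence.from W.minGenerates⇔
        (generates-σ closed ends' gen' , subst₂ _≤_ (sym (length-map _ S')) (sym (rank-σ p closed)) S'≤rank) ,
      ends-move σ S' ends'

  -- A closed realizable partition p of w corresponds to p ∘ σ on w', and one p' of w' to
  -- p' ∘ τ on w (whose image p' ∘ τ ∘ σ has the blocks of p').
  rotation-corresponds : Corresponding (suc n) L (suc n) L'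
  rotation-corresponds = forth , back
    where
    typeB-σ : ∀ {p} → Closed p → W.TypeB p ⇔ W'.TypeB (p ∘ σ)
    typeB-σ closed = ¬-⇔ (typeA-σ closed)
    forth : ∀ p → W.InQ p → ∃ λ p' → W'.InQ p' × (W.TypeB p ⇔ W'.TypeB p') × W.rank p ≡ W'.rank p'
    forth p (rp , closed) = p ∘ σ , (Equivalence.to (realizable-matches p (p ∘ σ) (matches-σ p closed)) rp , refl) ,
      typeB-σ closed , rank-σ p closed
    back : ∀ p' → W'.InQ p' → ∃ λ p → W.InQ p × (W.TypeB p ⇔ W'.TypeB p') × W.rank p ≡ W'.rank p'
    back p' (rp' , closed') = p , (rp , closed) , ⇔-trans (typeB-σ closed) typeB-blocks , trans (rank-σ p closed) (W'.rank-resp ⇒p' p'⇒)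
      where
      p : Sym → Sym
      p = p' ∘ τ
      rp : W.Realizable p
      rp = Equivalence.from (realizable-matches (p' ∘ τ) p' (matches-τ p' closed')) rp'
      closed : Closed p
      closed = cong p' (trans (τ-inject₁ fzero) (sym (τ-last n)))
      ⇒p' : W'.Refines (p ∘ σ) p'
      ⇒p' s t e = trans (sym (τ∘σ p' closed' s)) (trans e (τ∘σ p' closed' t))
      p'⇒ : W'.Refines p' (p ∘ σ)
      p'⇒ s t e = trans (τ∘σ p' closed' s) (trans e (sym (τ∘σ p' closed' t)))
      typeB-blocks : W'.TypeB (p ∘ σ) ⇔ W'.TypeB p'
      typeB-blocks = ¬-⇔ (mk⇔ (W'.TypeA-resp ⇒p' p'⇒) (W'.TypeA-resp p'⇒ ⇒p'))

corresponding-sym : ∀ {k m m'} {L : Fin m → Letter k} {L' : Fin m' → Letter k} →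
  Corresponding m L m' L' → Corresponding m' L' m L
corresponding-sym (forth , back) =
  (λ p' q' → let (p , q , B⇔B' , r≡r') = back p' q' in p , q , ⇔-sym B⇔B' , sym r≡r') ,
  (λ p q → let (p' , q' , B⇔B' , r≡r') = forth p q in p' , q' , ⇔-sym B⇔B' , sym r≡r')

corresponding-reindex : ∀ {k m₁ m₂ m'} (e : m₁ ≡ m₂) (L : Fin m₁ → Letter k) {L' : Fin m' → Letter k} →
  Corresponding m₂ (L ∘ subst Fin (sym e)) m' L' → Corresponding m₁ L m' L'
corresponding-reindex refl L c = c

-- For w : Word k the notions of Defs are, by definition, those of the trail
-- (length w, List.lookup w); only χ needs an argument, because Defs orients edges by a
-- with-abstraction on the sign.

χ-word : ∀ {k} (w : Word k) p → Defs.χ w p ≡ + Trail.rank (length w) (List.lookup w) p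
χ-word w p = trans (cong (λ es → + length (deduplicate T._≟E_ es) -ℤ + Defs.numVertices w p +ℤ + 1)
                         (map-cong edgeOf≡edge (allFin (length w))))
                   (T.χ≡rank p)
  where
  module T = Trail (length w) (List.lookup w)
  edgeOf≡edge : ∀ b → Defs.edgeOf w p b ≡ T.edge p b
  edgeOf≡edge b with Defs.sign w b
  ... | plus = refl
  ... | minus = refl

SameBeta : ∀ {k} → Word k → Word k → Set
SameBeta w w' = ∀ b → IsBeta w b ⇔ IsBeta w' b

-- β is determined by the closed partitions of type B and their χ = rank, so it is the
-- same for corresponding words.
isBeta-transfer : ∀ {k} (w w' : Word k) → Corresponding (length w) (List.lookup w) (length w') (List.lookup w') →
  ∀ b → IsBeta w b → IsBeta w' b
isBeta-transfer w w' (forth , back) nothing noTypeB p' inQ' typeB' with back p' inQ'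
... | p , inQ , B⇔B' , _ = noTypeB p inQ (Equivalence.from B⇔B' typeB')
isBeta-transfer w w' (forth , back) (just x) ((p , inQ , typeB , χ≡x) , minimal) = attained , bound
  where
  attained : ∃[ p' ] (Defs.InQ w' p' × Defs.TypeB w' p' × Defs.χ w' p' ≡ x)
  attained with forth p inQ
  ... | p' , inQ' , B⇔B' , rank≡ = p' , inQ' , Equivalence.to B⇔B' typeB ,
    trans (χ-word w' p') (trans (cong +_ (sym rank≡)) (trans (sym (χ-word w p)) χ≡x))
  bound : ∀ p' → Defs.InQ w' p' → Defs.TypeB w' p' → x ≤ℤ Defs.χ w' p'
  bound p' inQ' typeB' with back p' inQ'
  ... | p , inQ , B⇔B' , rank≡ = subst (x ≤ℤ_) (trans (χ-word w p) (trans (cong +_ rank≡) (sym (χ-word w' p'))))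
    (minimal p inQ (Equivalence.from B⇔B' typeB'))

sameBeta : ∀ {k} (w w' : Word k) → Corresponding (length w) (List.lookup w) (length w') (List.lookup w') → SameBeta w w'
sameBeta w w' c b = mk⇔ (isBeta-transfer w w' c b) (isBeta-transfer w' w (corresponding-sym c) b)

length-snoc : ∀ {A : Set} (y : List A) a → length (y ++ a ∷ []) ≡ suc (length y)
length-snoc y a = trans (length-++ y) (+-comm (length y) 1)

lookup-snoc-inject₁ : ∀ {A : Set} (y : List A) a .(e : suc (length y) ≡ length (y ++ a ∷ [])) i →
  List.lookup (y ++ a ∷ []) (cast e (inject₁ i)) ≡ List.lookup y i
lookup-snoc-inject₁ (b ∷ y) a e fzero = refl
lookup-snoc-inject₁ (b ∷ y) a e (fsuc i) = lookup-snoc-inject₁ y a (cong pred e) i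

lookup-snoc-last : ∀ {A : Set} (y : List A) a .(e : suc (length y) ≡ length (y ++ a ∷ [])) →
  List.lookup (y ++ a ∷ []) (cast e (fromℕ (length y))) ≡ a
lookup-snoc-last [] a e = refl
lookup-snoc-last (b ∷ y) a e = lookup-snoc-last y a (cong pred e)

rotation-sameBeta : ∀ {k} (y : Word k) a → SameBeta (y ++ a ∷ []) (a ∷ y)
rotation-sameBeta y a = sameBeta (y ++ a ∷ []) (a ∷ y)
  (corresponding-reindex (length-snoc y a) (List.lookup (y ++ a ∷ []))
    (Rotation.rotation-corresponds (length y) L (List.lookup (a ∷ y)) rotated))
  where
  e : suc (length y) ≡ length (y ++ a ∷ [])
  e = sym (length-snoc y a)
  L : Fin (suc (length y)) → Letter _
  L = List.lookup (y ++ a ∷ []) ∘ subst Fin e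
  rotated : ∀ j → List.lookup (a ∷ y) j ≡ L (rot j)
  rotated fzero = sym (trans (cong (List.lookup (y ++ a ∷ [])) (subst-is-cast e _)) (lookup-snoc-last y a e))
  rotated (fsuc i) = sym (trans (cong (List.lookup (y ++ a ∷ [])) (subst-is-cast e _)) (lookup-snoc-inject₁ y a e i))

-- A cyclic shift is a sequence of rotations by one letter.
shift-sameBeta : ∀ {k} (u v : Word k) → SameBeta (u ++ v) (v ++ u)
shift-sameBeta [] v = subst (SameBeta v) (sym (++-identityʳ v)) (λ _ → ⇔-refl)
shift-sameBeta (a ∷ u) v b = ⇔-trans (⇔-sym (rotation-sameBeta (u ++ v) a b))
  (subst₂ (λ w w' → IsBeta w b ⇔ IsBeta w' b) (sym (++-assoc u v (a ∷ []))) (++-assoc v (a ∷ []) u)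
    (shift-sameBeta u (v ++ a ∷ []) b))

lemma3 : ∀ {k : ℕ} (w w' : Word k) → CyclicShift w w' →
    ∀ (b : Maybe ℤ) → IsBeta w b ⇔ IsBeta w' b
lemma3 w w' (u , v , refl , refl) = shift-sameBeta u v
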